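{- If $(n;H_1,\dots,H_m)\in\mathcal{C}_{X_m,1,1}$, then there is a non-negative integer $\alpha_0\ge\max_{1\le i\le m}d_{0,i}$ such that $\sum_{i=1}^m d_{0,i}-(m-1)\alpha_0\ge0$.
   Context: Fix a prime $p$; $\mathbb{Z}_p$ is the $p$-adic integers; $\overline{\mathbb{Z}}_{\ge1}=\mathbb{Z}_{\ge1}\cup\{\infty\}$, $p^\infty=0$. $X_m=\{x_1,\dots,x_m\}$ is an ordered subset of $\mathbb{Z}_p$ of size $m$ with pairwise distinct reductions mod $p$. $\mathcal{M}_{\mathbb{Z}_p}$: isomorphism classes of finitely generated $\mathbb{Z}_p$-modules; $s(H)=\dim_{\mathbb{F}_p}(H/pH)$. $\mathcal{B}_m:=\{(n;H_1,\dots,H_m)\in\mathbb{Z}_{\ge0}\times\mathcal{M}_{\mathbb{Z}_p}^m: n\ge s(H_i)\ \forall i\}$; write $H_i\cong\prod_{r\in\overline{\mathbb{Z}}_{\ge1}}(\mathbb{Z}_p/p^r\mathbb{Z}_p)^{d_{r,i}}$ and $d_{0,i}:=n-\sum_{r\in\overline{\mathbb{Z}}_{\ge1}}d_{r,i}$. A first integral is a polynomial in $\operatorname{M}_n(\mathbb{Z}_p)[t]$ of the form $A_0+tA_1+pt^2A_2+\dots+p^{r}t^{r+1}A_{r+1}$. $\mathcal{C}_{X_m,1,1}$ is the set of $(n;H_1,\dots,H_m)\in\mathcal{B}_m$ such that some first integral $P(t)\in\operatorname{M}_n(\mathbb{Z}_p)[t]$ satisfies $\operatorname{cok}_{\mathbb{F}_p}(\overline{P(x_i)})\cong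 H_i/pH_i$ for all $i$, where $\overline{\,\cdot\,}$ is reduction mod $p$. -}

module Defs where

open import Data.Nat using (ℕ; zero; suc; _+_; _*_; _∸_; _^_; _≤_; NonZero)
open import Data.Nat.DivMod using (_%_)
open import Data.Nat.Properties using (m^n≢0)
open import Data.Fin using (Fin; zero; suc)
open import Data.List using (List; length)
open import Data.Product using (Σ; ∃; _×_; _,_)
open import Relation.Binary.PropositionalEquality using (_≡_)
open import Relation.Nullary using (¬_)

sumFin : (k : ℕ) → (Fin k → ℕ) → ℕ
sumFin zero    f = 0
sumFin (suc k) f = f zero + sumFin k (λ i → f (suc i))

-- p-adic integers, modelled as coherent sequences of integers:
-- a sequence s with s (k+1) ≡ s k  (mod p^k) for every k.
-- (Two sequences represent the same p-adic integer iff they agree mod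
-- p^k for all k; every notion below respects that equivalence.)

Seq : Set
Seq = ℕ → ℕ

module _ (p : ℕ) .{{_ : NonZero p}} where

  Coherent : Seq → Set
  Coherent s = ∀ k → _%_ (s (suc k)) (p ^ k) {{m^n≢0 p k}}
                   ≡ _%_ (s k) (p ^ k) {{m^n≢0 p k}}

  ℤp : Set
  ℤp = Σ Seq Coherent

  red : ℤp → ℕ
  red (s , _) = s 1 % p

_+ˢ_ : Seq → Seq → Seq
(a +ˢ b) k = a k + b k

_*ˢ_ : Seq → Seq → Seq
(a *ˢ b) k = a k * b k

_^ˢ_ : Seq → ℕ → Seq
(a ^ˢ e) k = a k ^ e

constˢ : ℕ → Seq
constˢ c k = c

-- A first integral is P(t) = A₀ + t A₁ + p t² A₂ + … + p^r t^(r+1) A_(r+1),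
-- given by the bound r and the coefficient matrices A : ℕ → Mat
-- (only A 0, …, A (r+1) are used).

module _ (p : ℕ) .{{_ : NonZero p}} where

  MatZp : ℕ → Set
  MatZp n = Fin n → Fin n → ℤp p

  rep : ℤp p → Seq
  rep (s , _) = s

  higherTerms : {n : ℕ} → ℕ → (ℕ → MatZp n) → Seq → Fin n → Fin n → Seq
  higherTerms zero    A x a b = constˢ 0
  higherTerms (suc j) A x a b =
    higherTerms j A x a b
      +ˢ ((constˢ (p ^ suc j) *ˢ (x ^ˢ (suc (suc j)))) *ˢ rep (A (suc (suc j)) a b))

  evalFI : {n : ℕ} → (r : ℕ) → (ℕ → MatZp n) → ℤp p → Fin n → Fin n → Seq
  evalFI r A x a b =
    (rep (A 0 a b) +ˢ (rep x *ˢ rep (A 1 a b))) +ˢ higherTerms r A (rep x) a b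

  redEvalFI : {n : ℕ} → (r : ℕ) → (ℕ → MatZp n) → ℤp p → Fin n → Fin n → ℕ
  redEvalFI r A x a b = evalFI r A x a b 1 % p

  LinIndepCols : {n k : ℕ} → (Fin n → Fin n → ℕ) → (Fin k → Fin n) → Set
  LinIndepCols {n} {k} M cols =
    (c : Fin k → ℕ) →
    (∀ a → sumFin k (λ j → c j * M a (cols j)) % p ≡ 0) →
    ∀ j → c j % p ≡ 0

  HasRank : {n : ℕ} → (Fin n → Fin n → ℕ) → ℕ → Set
  HasRank {n} M ρ =
    (∃ λ (cols : Fin ρ → Fin n) → LinIndepCols M cols) ×
    ((cols : Fin (suc ρ) → Fin n) → ¬ LinIndepCols M cols)

  -- dim_{F_p} cok(M) = d   (cok(M) = F_p^n / image(M), of dimension n - rank M)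
  CokDim : {n : ℕ} → (Fin n → Fin n → ℕ) → ℕ → Set
  CokDim {n} M d = (d ≤ n) × HasRank M (n ∸ d)

-- Finitely generated Z_p-modules, up to isomorphism, via the structure
-- theorem: H ≅ ∏ Z_p / p^(e) Z_p over a finite list of exponents
-- e ∈ Z̄_{≥1} = {1,2,…} ∪ {∞}  (p^∞ = 0, giving a free summand Z_p).
-- Isomorphism classes correspond to such lists up to permutation.

data Exp : Set where
  fin : ℕ → Exp    -- fin r stands for exponent r+1
  ∞   : Exp

FGModule : Set
FGModule = List Exp

-- s(H) = dim_{F_p} (H / pH) = number of cyclic summands (= Σ_{r ≥ 1, ∞} d_r)
s : FGModule → ℕ
s H = length H

d₀ : ℕ → FGModule → ℕ
d₀ n H = n ∸ s H

InB : {m : ℕ} → ℕ → (Fin m → FGModule) → Set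
InB n H = ∀ i → s (H i) ≤ n

-- (n; H₁,…,H_m) ∈ C_{X_m,1,1}
-- H_i/pH_i ≅ F_p^{s(H_i)}, so cok(P(x_i) mod p) ≅ H_i/pH_i iff its F_p-dimension is s(H_i).
InC : (p : ℕ) .{{_ : NonZero p}} → {m : ℕ} → (Fin m → ℤp p) →
      ℕ → (Fin m → FGModule) → Set
InC p {m} X n H =
  InB n H ×
  (∃ λ (r : ℕ) → ∃ λ (A : ℕ → MatZp p n) →
     ∀ i → CokDim p (redEvalFI p r A (X i)) (s (H i)))

{-# OPTIONS --safe #-}
-- Modulo p a first integral is the linear pencil A₀ + t A₁, and d₀,ᵢ is the rank ρᵢ of
-- A₀ + xᵢ A₁ over F_p.  Let R = ρ_{i₀} be the largest rank and S a set of R independent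
-- columns at x_{i₀}.  Restricted to the columns S, the pencil has kernels at the distinct
-- points xᵢ that form a direct sum in F_p^R, so Σᵢ (R − ρᵢ) ≤ R, i.e. (m − 1) R ≤ Σᵢ ρᵢ,
-- and α₀ = R works.  To avoid rank–nullity, this is proved by exhibiting m R independent
-- vectors in F_p^(R + Σᵢ ρᵢ): the vector for (i, b) records e_b and the coordinates of
-- column S b of A₀ + xᵢ A₁ in a basis of its column space.
module Submission where

open import Defs
open import Data.Nat using (ℕ; zero; suc; _+_; _*_; _∸_; _^_; _≤_; _≤?_; z≤n; s≤s; NonZero; nonTrivial⇒n>1; ≢-nonZero⁻¹; _≟_)
open import Data.Nat.Properties
open import Data.Nat.DivMod using (_%_; %-distribˡ-+; %-distribˡ-*; %-remove-+ˡ; %-remove-+ʳ; m*n%n≡0; m<n⇒m%n≡m; m%n%n≡m%n)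
open import Data.Nat.Divisibility using (_∣_; m%n≡0⇒n∣m; n∣m⇒m%n≡0; divides; ∣m⇒∣m*n; m∣m*n; ∣m∣n⇒∣m+n)
open import Data.Nat.Primality using (Prime; euclidsLemma; prime⇒irreducible; prime⇒nonTrivial)
open import Data.Nat.Coprimality using (Coprime; coprime-Bézout)
open import Data.Nat.GCD using (module Bézout)
open import Data.Nat.Tactic.RingSolver using (solve-∀)
open import Data.Fin using (Fin; zero; suc; punchIn; punchOut; _↑ˡ_; _↑ʳ_; splitAt; combine; remQuot)
  renaming (_≟_ to _≟ᶠ_)
open import Data.Fin.Properties
  using (any?; punchIn-punchOut; splitAt-↑ˡ; splitAt-↑ʳ; remQuot-combine; combine-remQuot)
  renaming (suc-injective to fsuc-injective)
open import Data.Vec.Functional using (_∷_)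
open import Data.Product using (Σ; ∃; _×_; _,_; proj₁; proj₂; uncurry)
open import Data.Sum using (inj₁; inj₂; [_,_])
open import Data.Empty using (⊥-elim)
open import Function using (_∘_)
open import Relation.Nullary using (¬_; yes; no; Dec)
open import Relation.Nullary.Decidable using (¬?; decidable-stable)
open import Relation.Binary.PropositionalEquality
  using (_≡_; _≢_; refl; sym; trans; cong; cong₂; subst; module ≡-Reasoning)

sumFin-cong : ∀ k {f g : Fin k → ℕ} → (∀ j → f j ≡ g j) → sumFin k f ≡ sumFin k g
sumFin-cong zero    e = refl
sumFin-cong (suc k) e = cong₂ _+_ (e zero) (sumFin-cong k (e ∘ suc))

sumFin-zero : ∀ k → sumFin k (λ _ → 0) ≡ 0
sumFin-zero zero    = refl
sumFin-zero (suc k) = sumFin-zero k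

sumFin-+ : ∀ k (f g : Fin k → ℕ) → sumFin k (λ j → f j + g j) ≡ sumFin k f + sumFin k g
sumFin-+ zero    f g = refl
sumFin-+ (suc k) f g rewrite sumFin-+ k (f ∘ suc) (g ∘ suc) =
  +-+-comm (f zero) (g zero) (sumFin k (f ∘ suc)) (sumFin k (g ∘ suc))
  where
  +-+-comm : ∀ a b c d → a + b + (c + d) ≡ a + c + (b + d)
  +-+-comm = solve-∀

sumFin-*ˡ : ∀ k c (f : Fin k → ℕ) → sumFin k (λ j → c * f j) ≡ c * sumFin k f
sumFin-*ˡ zero    c f = sym (*-zeroʳ c)
sumFin-*ˡ (suc k) c f rewrite sumFin-*ˡ k c (f ∘ suc) = sym (*-distribˡ-+ c (f zero) _)

sumFin-*ʳ : ∀ k c (f : Fin k → ℕ) → sumFin k (λ j → f j * c) ≡ sumFin k f * c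
sumFin-*ʳ k c f = begin
  sumFin k (λ j → f j * c) ≡⟨ sumFin-cong k (λ j → *-comm (f j) c) ⟩
  sumFin k (λ j → c * f j) ≡⟨ sumFin-*ˡ k c f ⟩
  c * sumFin k f           ≡⟨ *-comm c _ ⟩
  sumFin k f * c           ∎
  where open ≡-Reasoning

sumFin-swap : ∀ k l (f : Fin k → Fin l → ℕ) →
  sumFin k (λ j → sumFin l (f j)) ≡ sumFin l (λ i → sumFin k (λ j → f j i))
sumFin-swap zero    l f = sym (sumFin-zero l)
sumFin-swap (suc k) l f rewrite sumFin-swap k l (f ∘ suc) =
  sym (sumFin-+ l (f zero) (λ i → sumFin k (λ j → f (suc j) i)))

sumFin-↑ : ∀ a b (f : Fin (a + b) → ℕ) →
  sumFin (a + b) f ≡ sumFin a (λ j → f (j ↑ˡ b)) + sumFin b (λ j → f (a ↑ʳ j))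
sumFin-↑ zero    b f = refl
sumFin-↑ (suc a) b f rewrite sumFin-↑ a b (f ∘ suc) = sym (+-assoc (f zero) _ _)

sumFin-combine : ∀ m n (f : Fin (m * n) → ℕ) →
  sumFin (m * n) f ≡ sumFin m (λ i → sumFin n (λ b → f (combine i b)))
sumFin-combine zero    n f = refl
sumFin-combine (suc m) n f rewrite sumFin-↑ n (m * n) f =
  cong (sumFin n (λ j → f (j ↑ˡ (m * n))) +_) (sumFin-combine m n (λ j → f (n ↑ʳ j)))

sumFin-single : ∀ k (f : Fin k → ℕ) j₀ → (∀ j → j ≢ j₀ → f j ≡ 0) → sumFin k f ≡ f j₀
sumFin-single (suc k) f zero off = begin
  f zero + sumFin k (f ∘ suc) ≡⟨ cong (f zero +_) (sumFin-cong k (λ j → off (suc j) (λ ()))) ⟩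
  f zero + sumFin k (λ _ → 0) ≡⟨ cong (f zero +_) (sumFin-zero k) ⟩
  f zero + 0                  ≡⟨ +-identityʳ _ ⟩
  f zero                      ∎
  where open ≡-Reasoning
sumFin-single (suc k) f (suc j₀) off =
  trans (cong (_+ sumFin k (f ∘ suc)) (off zero (λ ())))
        (sumFin-single k (f ∘ suc) j₀ (λ j j≢j₀ → off (suc j) (j≢j₀ ∘ fsuc-injective)))

δ : ∀ {k} → Fin k → Fin k → ℕ
δ i j with i ≟ᶠ j
... | yes _ = 1
... | no  _ = 0

δ-refl : ∀ {k} (i : Fin k) → δ i i ≡ 1
δ-refl i with i ≟ᶠ i
... | yes _   = refl
... | no  i≢i = ⊥-elim (i≢i refl)

δ-≢ : ∀ {k} {i j : Fin k} → i ≢ j → δ i j ≡ 0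
δ-≢ {i = i} {j} i≢j with i ≟ᶠ j
... | yes i≡j = ⊥-elim (i≢j i≡j)
... | no  _   = refl

sumFin-δ : ∀ k (f : Fin k → ℕ) j₀ → sumFin k (λ j → f j * δ j j₀) ≡ f j₀
sumFin-δ k f j₀ = begin
  sumFin k (λ j → f j * δ j j₀) ≡⟨ sumFin-single k _ j₀ (λ j j≢j₀ → trans (cong (f j *_) (δ-≢ j≢j₀)) (*-zeroʳ (f j))) ⟩
  f j₀ * δ j₀ j₀                ≡⟨ cong (f j₀ *_) (δ-refl j₀) ⟩
  f j₀ * 1                      ≡⟨ *-identityʳ (f j₀) ⟩
  f j₀                          ∎
  where open ≡-Reasoning

blockOf : ∀ {m} (ρ : Fin m → ℕ) → Fin (sumFin m ρ) → Σ (Fin m) (Fin ∘ ρ)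
blockOf {suc m} ρ y with splitAt (ρ zero) y
... | inj₁ t  = zero , t
... | inj₂ y′ = suc (proj₁ (blockOf (ρ ∘ suc) y′)) , proj₂ (blockOf (ρ ∘ suc) y′)

inBlock : ∀ {m} (ρ : Fin m → ℕ) (i : Fin m) → Fin (ρ i) → Fin (sumFin m ρ)
inBlock {suc m} ρ zero    t = t ↑ˡ sumFin m (ρ ∘ suc)
inBlock {suc m} ρ (suc i) t = ρ zero ↑ʳ inBlock (ρ ∘ suc) i t

blockOf-inBlock : ∀ {m} (ρ : Fin m → ℕ) i t → blockOf ρ (inBlock ρ i t) ≡ (i , t)
blockOf-inBlock {suc m} ρ zero t rewrite splitAt-↑ˡ (ρ zero) t (sumFin m (ρ ∘ suc)) = refl
blockOf-inBlock {suc m} ρ (suc i) t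
  rewrite splitAt-↑ʳ (ρ zero) (sumFin m (ρ ∘ suc)) (inBlock (ρ ∘ suc) i t)
        | blockOf-inBlock (ρ ∘ suc) i t = refl

maxIndex : ∀ m (f : Fin (suc m) → ℕ) → ∃ λ i₀ → ∀ i → f i ≤ f i₀
maxIndex zero    f = zero , λ { zero → ≤-refl }
maxIndex (suc m) f with maxIndex m (f ∘ suc)
... | j , f∘suc≤fj with f zero ≤? f (suc j)
...   | yes f0≤ = suc j , λ { zero → f0≤ ; (suc i) → f∘suc≤fj i }
...   | no  f0≰ = zero  , λ { zero → ≤-refl ; (suc i) → ≤-trans (f∘suc≤fj i) (<⇒≤ (≰⇒> f0≰)) }

¬¬-Π : ∀ k {B : Fin k → Set} → (∀ j → ¬ ¬ B j) → ¬ ¬ (∀ j → B j)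
¬¬-Π zero    h k = k (λ ())
¬¬-Π (suc k) h kk =
  h zero (λ b₀ → ¬¬-Π k (h ∘ suc) (λ bs → kk (λ { zero → b₀ ; (suc j) → bs j })))

infixl 7 _·_
_·_ : ∀ {n k} → (Fin n → Fin k → ℕ) → (Fin k → ℕ) → Fin n → ℕ
_·_ {k = k} M v a = sumFin k (λ b → v b * M a b)

·-scale : ∀ {n k} (M : Fin n → Fin k → ℕ) s v a → (M · (λ b → s * v b)) a ≡ s * (M · v) a
·-scale {k = k} M s v a = trans (sumFin-cong k (λ b → *-assoc s (v b) (M a b))) (sumFin-*ˡ k s _)

·-sumFin : ∀ {n k} l (M : Fin n → Fin k → ℕ) (v : Fin l → Fin k → ℕ) a →
  sumFin l (λ j → (M · v j) a) ≡ (M · (λ b → sumFin l (λ j → v j b))) a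
·-sumFin {k = k} l M v a =
  trans (sumFin-swap l k (λ j b → v j b * M a b)) (sumFin-cong k (λ b → sumFin-*ʳ l (M a b) (λ j → v j b)))

module PrimeField (p : ℕ) .{{_ : NonZero p}} (p-prime : Prime p) where

  infix 4 _≈_
  _≈_ : ℕ → ℕ → Set
  a ≈ b = a % p ≡ b % p

  IsZero : ℕ → Set
  IsZero a = a % p ≡ 0

  isZero? : ∀ a → Dec (IsZero a)
  isZero? a = a % p ≟ 0

  p≥1 : 1 ≤ p
  p≥1 = n≢0⇒n>0 (≢-nonZero⁻¹ p)

  0%p≡0 : 0 % p ≡ 0
  0%p≡0 = m<n⇒m%n≡m p≥1

  IsZero⇒≈0 : ∀ {a} → IsZero a → a ≈ 0
  IsZero⇒≈0 a%p≡0 = trans a%p≡0 (sym 0%p≡0)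

  ≈0⇒IsZero : ∀ {a} → a ≈ 0 → IsZero a
  ≈0⇒IsZero a≈0 = trans a≈0 0%p≡0

  ≡⇒≈ : ∀ {a b} → a ≡ b → a ≈ b
  ≡⇒≈ = cong (_% p)

  +-cong : ∀ {a a′ b b′} → a ≈ a′ → b ≈ b′ → a + b ≈ a′ + b′
  +-cong {a} {a′} {b} {b′} a≈a′ b≈b′ = begin
    (a + b) % p           ≡⟨ %-distribˡ-+ a b p ⟩
    (a % p + b % p) % p   ≡⟨ cong₂ (λ u v → (u + v) % p) a≈a′ b≈b′ ⟩
    (a′ % p + b′ % p) % p ≡⟨ %-distribˡ-+ a′ b′ p ⟨
    (a′ + b′) % p         ∎
    where open ≡-Reasoning

  *-cong : ∀ {a a′ b b′} → a ≈ a′ → b ≈ b′ → a * b ≈ a′ * b′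
  *-cong {a} {a′} {b} {b′} a≈a′ b≈b′ = begin
    (a * b) % p             ≡⟨ %-distribˡ-* a b p ⟩
    (a % p * (b % p)) % p   ≡⟨ cong₂ (λ u v → (u * v) % p) a≈a′ b≈b′ ⟩
    (a′ % p * (b′ % p)) % p ≡⟨ %-distribˡ-* a′ b′ p ⟨
    (a′ * b′) % p           ∎
    where open ≡-Reasoning

  *-zeroˡ-≈ : ∀ {a} b → a ≈ 0 → a * b ≈ 0
  *-zeroˡ-≈ b a≈0 = *-cong {b = b} a≈0 refl

  *-zeroʳ-≈ : ∀ a {b} → b ≈ 0 → a * b ≈ 0
  *-zeroʳ-≈ a b≈0 = trans (*-cong {a} refl b≈0) (≡⇒≈ (*-zeroʳ a))

  -- Negation in F_p is multiplication by p ∸ 1, since ℕ has no subtraction.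
  neg : ℕ → ℕ
  neg a = (p ∸ 1) * a

  +-neg≡p* : ∀ a → a + neg a ≡ p * a
  +-neg≡p* a = begin
    a + (p ∸ 1) * a     ≡⟨ cong (_+ (p ∸ 1) * a) (*-identityˡ a) ⟨
    1 * a + (p ∸ 1) * a ≡⟨ *-distribʳ-+ a 1 (p ∸ 1) ⟨
    (1 + (p ∸ 1)) * a   ≡⟨ cong (_* a) (m+[n∸m]≡n p≥1) ⟩
    p * a               ∎
    where open ≡-Reasoning

  p*≈0 : ∀ a → p * a ≈ 0
  p*≈0 a = trans (≡⇒≈ (*-comm p a)) (IsZero⇒≈0 (m*n%n≡0 a p))

  +-neg≈0 : ∀ a → a + neg a ≈ 0
  +-neg≈0 a = trans (≡⇒≈ (+-neg≡p* a)) (p*≈0 a)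

  +-cancelʳ-≈ : ∀ {a b} z → a + z ≈ b + z → a ≈ b
  +-cancelʳ-≈ {a} {b} z a+z≈b+z = begin
    a % p                ≡⟨ %-remove-+ʳ a (divides z (*-comm p z)) ⟨
    (a + p * z) % p      ≡⟨ ≡⇒≈ (cong (a +_) (+-neg≡p* z)) ⟨
    (a + (z + neg z)) % p ≡⟨ ≡⇒≈ (+-assoc a z (neg z)) ⟨
    (a + z + neg z) % p  ≡⟨ +-cong {a + z} {b + z} {neg z} a+z≈b+z refl ⟩
    (b + z + neg z) % p  ≡⟨ ≡⇒≈ (+-assoc b z (neg z)) ⟩
    (b + (z + neg z)) % p ≡⟨ ≡⇒≈ (cong (b +_) (+-neg≡p* z)) ⟩
    (b + p * z) % p      ≡⟨ %-remove-+ʳ b (divides z (*-comm p z)) ⟩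
    b % p                ∎
    where open ≡-Reasoning

  +-neg⇒≈ : ∀ {a b} → a + neg b ≈ 0 → a ≈ b
  +-neg⇒≈ {b = b} a-b≈0 = +-cancelʳ-≈ (neg b) (trans a-b≈0 (sym (+-neg≈0 b)))

  +-inverse-unique : ∀ {x a b} → x + a ≈ 0 → x + b ≈ 0 → a ≈ b
  +-inverse-unique {x} {a} {b} x+a≈0 x+b≈0 =
    +-cancelʳ-≈ x (trans (≡⇒≈ (+-comm a x)) (trans x+a≈0 (trans (sym x+b≈0) (≡⇒≈ (+-comm x b)))))

  +≈0⇒≈0ˡ : ∀ {x a} → x + a ≈ 0 → a ≈ 0 → x ≈ 0
  +≈0⇒≈0ˡ {x} {a} x+a≈0 a≈0 = +-cancelʳ-≈ a (trans x+a≈0 (sym (+-cong {0} {0} refl a≈0)))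

  +≈0⇒≈0ʳ : ∀ {a x} → a + x ≈ 0 → a ≈ 0 → x ≈ 0
  +≈0⇒≈0ʳ {a} {x} a+x≈0 = +≈0⇒≈0ˡ (trans (≡⇒≈ (+-comm x a)) a+x≈0)

  1≉0 : ¬ (1 ≈ 0)
  1≉0 1≈0 = 1+n≢0 (trans (sym (m<n⇒m%n≡m (nonTrivial⇒n>1 p {{prime⇒nonTrivial p-prime}}))) (≈0⇒IsZero 1≈0))

  noZeroDivisorsˡ : ∀ {a b} → IsZero (a * b) → ¬ IsZero b → IsZero a
  noZeroDivisorsˡ {a} {b} ab≈0 b≉0 with euclidsLemma a b p-prime (m%n≡0⇒n∣m _ p ab≈0)
  ... | inj₁ p∣a = n∣m⇒m%n≡0 a p p∣a
  ... | inj₂ p∣b = ⊥-elim (b≉0 (n∣m⇒m%n≡0 b p p∣b))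

  noZeroDivisorsʳ : ∀ {a b} → IsZero (a * b) → ¬ IsZero a → IsZero b
  noZeroDivisorsʳ {a} {b} ab≈0 = noZeroDivisorsˡ (trans (≡⇒≈ (*-comm b a)) ab≈0)

  coprime : ∀ a → ¬ IsZero a → Coprime a p
  coprime a a≉0 (d∣a , d∣p) with prime⇒irreducible p-prime d∣p
  ... | inj₁ d≡1 = d≡1
  ... | inj₂ refl = ⊥-elim (a≉0 (n∣m⇒m%n≡0 a p d∣a))

  inverse : ∀ a → ¬ IsZero a → ∃ λ b → b * a ≈ 1
  inverse a a≉0 with coprime-Bézout (coprime a a≉0)
  ... | Bézout.+- u v 1+va≡up = u , sym (trans (sym (%-remove-+ʳ 1 (divides v refl))) (≡⇒≈ 1+va≡up))
  ... | Bézout.-+ u v 1+ua≡vp = neg u , (begin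
    (neg u * a) % p                           ≡⟨ %-remove-+ʳ (neg u * a) (divides 1 (sym (*-identityˡ p))) ⟨
    (neg u * a + p) % p                       ≡⟨ cong (λ t → (neg u * a + t) % p) (m+[n∸m]≡n p≥1) ⟨
    ((p ∸ 1) * u * a + (1 + (p ∸ 1))) % p     ≡⟨ cong (_% p) (regroup (p ∸ 1) u a) ⟩
    ((p ∸ 1) * (1 + u * a) + 1) % p           ≡⟨ cong (λ t → ((p ∸ 1) * t + 1) % p) 1+ua≡vp ⟩
    ((p ∸ 1) * (v * p) + 1) % p               ≡⟨ %-remove-+ˡ 1 (divides ((p ∸ 1) * v) (sym (*-assoc (p ∸ 1) v p))) ⟩
    1 % p                                     ∎)
    where
    open ≡-Reasoning
    regroup : ∀ k u a → k * u * a + (1 + k) ≡ k * (1 + u * a) + 1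
    regroup = solve-∀

  -- Junk value 0 at a ≈ 0, which inv-injective exploits.
  inv : ℕ → ℕ
  inv a with isZero? a
  ... | yes _   = 0
  ... | no  a≉0 = proj₁ (inverse a a≉0)

  inv-zero : ∀ {a} → IsZero a → inv a ≡ 0
  inv-zero {a} a≈0 with isZero? a
  ... | yes _   = refl
  ... | no  a≉0 = ⊥-elim (a≉0 a≈0)

  *-inverseˡ : ∀ {a} → ¬ IsZero a → inv a * a ≈ 1
  *-inverseˡ {a} a≉0 with isZero? a
  ... | yes a≈0 = ⊥-elim (a≉0 a≈0)
  ... | no  a≉0 = proj₂ (inverse a a≉0)

  inv-injective : ∀ {a b} → ¬ IsZero a → inv a ≈ inv b → a ≈ b
  inv-injective {a} {b} a≉0 ia≈ib = cases (isZero? b)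
    where
    open ≡-Reasoning
    swap : ∀ a i b → a * (i * b) ≡ i * a * b
    swap = solve-∀
    cases : Dec (IsZero b) → a ≈ b
    cases (yes b≈0) = ⊥-elim (1≉0 (trans (sym (*-inverseˡ a≉0))
                                     (*-zeroˡ-≈ a (trans ia≈ib (≡⇒≈ (inv-zero b≈0))))))
    cases (no b≉0) = begin
      a % p                   ≡⟨ ≡⇒≈ (*-identityʳ a) ⟨
      (a * 1) % p             ≡⟨ *-cong {a} refl (*-inverseˡ b≉0) ⟨
      (a * (inv b * b)) % p   ≡⟨ *-cong {a} refl (*-cong {b = b} ia≈ib refl) ⟨
      (a * (inv a * b)) % p   ≡⟨ ≡⇒≈ (swap a (inv a) b) ⟩
      (inv a * a * b) % p     ≡⟨ *-cong {b = b} (*-inverseˡ a≉0) refl ⟩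
      (1 * b) % p             ≡⟨ ≡⇒≈ (*-identityˡ b) ⟩
      b % p                   ∎

  solve-linear : ∀ {g v s} → ¬ IsZero g → g * v + s ≈ 0 → v ≈ neg (inv g) * s
  solve-linear {g} {v} {s} g≉0 gv+s≈0 = begin
    v % p               ≡⟨ ≡⇒≈ (*-identityˡ v) ⟨
    (1 * v) % p         ≡⟨ *-cong {b = v} (*-inverseˡ g≉0) refl ⟨
    (inv g * g * v) % p ≡⟨ +-inverse-unique {inv g * s} scaled cancelled ⟩
    (neg (inv g) * s) % p ∎
    where
    open ≡-Reasoning
    expand : ∀ i g v s → i * s + i * g * v ≡ i * (g * v + s)
    expand = solve-∀
    scaled : inv g * s + inv g * g * v ≈ 0
    scaled = trans (≡⇒≈ (expand (inv g) g v s)) (*-zeroʳ-≈ (inv g) gv+s≈0)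
    cancelled : inv g * s + neg (inv g) * s ≈ 0
    cancelled = trans (≡⇒≈ (sym (*-distribʳ-+ s (inv g) (neg (inv g))))) (*-zeroˡ-≈ s (+-neg≈0 (inv g)))

  sumFin-cong-≈ : ∀ k {f g : Fin k → ℕ} → (∀ j → f j ≈ g j) → sumFin k f ≈ sumFin k g
  sumFin-cong-≈ zero    f≈g = refl
  sumFin-cong-≈ (suc k) f≈g = +-cong (f≈g zero) (sumFin-cong-≈ k (f≈g ∘ suc))

  sumFin-≈0 : ∀ k {f : Fin k → ℕ} → (∀ j → f j ≈ 0) → sumFin k f ≈ 0
  sumFin-≈0 k f≈0 = trans (sumFin-cong-≈ k f≈0) (≡⇒≈ (sumFin-zero k))

  ·-≈0 : ∀ {n k} (M : Fin n → Fin k → ℕ) {v} → (∀ b → v b ≈ 0) → ∀ a → (M · v) a ≈ 0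
  ·-≈0 {k = k} M v≈0 a = sumFin-≈0 k (λ b → *-zeroˡ-≈ (M a b) (v≈0 b))

  Independent : ∀ {k l} → (Fin k → Fin l → ℕ) → Set
  Independent {k} u = (c : Fin k → ℕ) → (∀ i → IsZero (sumFin k (λ j → c j * u j i))) → ∀ j → IsZero (c j)

  Independent-resp-≈ : ∀ {k l} {u v : Fin k → Fin l → ℕ} → (∀ j i → u j i ≈ v j i) → Independent u → Independent v
  Independent-resp-≈ {k} u≈v u-indep c cv≈0 = u-indep c λ i →
    ≈0⇒IsZero (trans (sumFin-cong-≈ k (λ j → *-cong {c j} refl (u≈v j i))) (IsZero⇒≈0 (cv≈0 i)))

  independent⇒nonzero : ∀ {k l} {u : Fin k → Fin l → ℕ} → Independent u → ∀ j → ¬ (∀ i → IsZero (u j i))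
  independent⇒nonzero {k} {u = u} u-indep j uj≈0 =
    1≉0 (trans (≡⇒≈ (sym (δ-refl j))) (IsZero⇒≈0 (u-indep (λ j′ → δ j′ j) δ-combination j)))
    where
    δ-combination : ∀ i → IsZero (sumFin k (λ j′ → δ j′ j * u j′ i))
    δ-combination i = trans (≡⇒≈ (trans (sumFin-cong k (λ j′ → *-comm (δ j′ j) (u j′ i)))
                                        (sumFin-δ k (λ j′ → u j′ i) j)))
                            (uj≈0 i)

  -- Clearing coordinate i₀ of the tail vectors with the pivot u zero i₀.
  eliminate-independent : ∀ {k l} (u : Fin (suc k) → Fin (suc l) → ℕ) (i₀ : Fin (suc l)) →
    Independent u → ¬ IsZero (u zero i₀) →
    Independent (λ j i → u zero i₀ * u (suc j) (punchIn i₀ i) + neg (u (suc j) i₀) * u zero (punchIn i₀ i))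
  eliminate-independent {k} u i₀ u-indep pivot≉0 c′ c′w≈0 j = noZeroDivisorsˡ (c≈0 (suc j)) pivot≉0
    where
    π : ℕ
    π = u zero i₀
    w : Fin k → Fin _ → ℕ
    w j i = π * u (suc j) i + neg (u (suc j) i₀) * u zero i
    c : Fin (suc k) → ℕ
    c zero    = sumFin k (λ j → c′ j * neg (u (suc j) i₀))
    c (suc j) = c′ j * π
    same-combination : ∀ i → sumFin (suc k) (λ j → c j * u j i) ≡ sumFin k (λ j → c′ j * w j i)
    same-combination i = sym (begin
      sumFin k (λ j → c′ j * w j i)
        ≡⟨ sumFin-cong k (λ j → distrib (c′ j) π (u (suc j) i) (neg (u (suc j) i₀)) (u zero i)) ⟩
      sumFin k (λ j → c′ j * π * u (suc j) i + c′ j * neg (u (suc j) i₀) * u zero i)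
        ≡⟨ sumFin-+ k _ _ ⟩
      sumFin k (λ j → c′ j * π * u (suc j) i) + sumFin k (λ j → c′ j * neg (u (suc j) i₀) * u zero i)
        ≡⟨ cong (sumFin k (λ j → c′ j * π * u (suc j) i) +_) (sumFin-*ʳ k (u zero i) _) ⟩
      sumFin k (λ j → c′ j * π * u (suc j) i) + c zero * u zero i
        ≡⟨ +-comm (sumFin k (λ j → c′ j * π * u (suc j) i)) _ ⟩
      c zero * u zero i + sumFin k (λ j → c′ j * π * u (suc j) i) ∎)
      where
      open ≡-Reasoning
      distrib : ∀ a b x y z → a * (b * x + y * z) ≡ a * b * x + a * y * z
      distrib = solve-∀
    pivot-column : IsZero (sumFin k (λ j → c′ j * w j i₀))
    pivot-column = ≈0⇒IsZero (sumFin-≈0 k λ j →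
      trans (≡⇒≈ (factor (c′ j) π (u (suc j) i₀) (neg (u (suc j) i₀))))
            (*-zeroʳ-≈ (c′ j * π) (+-neg≈0 (u (suc j) i₀))))
      where
      factor : ∀ a b x y → a * (b * x + y * b) ≡ a * b * (x + y)
      factor = solve-∀
    combination≈0 : ∀ i → IsZero (sumFin k (λ j → c′ j * w j i))
    combination≈0 i with i ≟ᶠ i₀
    ... | yes refl = pivot-column
    ... | no  i≢i₀ = subst (λ t → IsZero (sumFin k (λ j → c′ j * w j t)))
                           (punchIn-punchOut (i≢i₀ ∘ sym)) (c′w≈0 (punchOut (i≢i₀ ∘ sym)))
    c≈0 : ∀ j → IsZero (c j)
    c≈0 = u-indep c (λ i → trans (≡⇒≈ (same-combination i)) (combination≈0 i))

  independent⇒≤ : ∀ k l (u : Fin k → Fin l → ℕ) → Independent u → k ≤ l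
  independent⇒≤ zero    l       u u-indep = z≤n
  independent⇒≤ (suc k) zero    u u-indep = ⊥-elim (independent⇒nonzero {u = u} u-indep zero (λ ()))
  independent⇒≤ (suc k) (suc l) u u-indep with any? (λ i → ¬? (isZero? (u zero i)))
  ... | yes (i₀ , pivot≉0) = s≤s (independent⇒≤ k l (λ j i → u zero i₀ * u (suc j) (punchIn i₀ i) + neg (u (suc j) i₀) * u zero (punchIn i₀ i))
                                   (eliminate-independent u i₀ u-indep pivot≉0))
  ... | no  no-pivot       = ⊥-elim (independent⇒nonzero {u = u} u-indep zero λ i →
                               decidable-stable (isZero? (u zero i)) (λ u₀ᵢ≉0 → no-pivot (i , u₀ᵢ≉0)))

  InSpan : ∀ {k l} → (Fin k → Fin l → ℕ) → (Fin l → ℕ) → Set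
  InSpan {k} u v = Σ (Fin k → ℕ) λ α → ∀ i → v i ≈ sumFin k (λ t → α t * u t i)

  dependent-extension-spans : ∀ {k l} (u : Fin k → Fin l → ℕ) (v : Fin l → ℕ) →
    Independent u → ¬ Independent (v ∷ u) → ¬ ¬ InSpan u v
  dependent-extension-spans {k} u v u-indep v∷u-dependent v∉span = v∷u-dependent v∷u-indep
    where
    uᵀ : Fin _ → Fin k → ℕ
    uᵀ i t = u t i
    v∷u-indep : Independent (v ∷ u)
    v∷u-indep γ γ≈0 = λ { zero → γ₀≈0 ; (suc t) → γ-tail≈0 t }
      where
      in-span : ¬ IsZero (γ zero) → InSpan u v
      in-span γ₀≉0 = (λ t → neg (inv (γ zero)) * γ (suc t)) , λ i →
        trans (solve-linear γ₀≉0 (IsZero⇒≈0 (γ≈0 i))) (≡⇒≈ (sym (·-scale uᵀ (neg (inv (γ zero))) (γ ∘ suc) i)))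
      γ₀≈0 : IsZero (γ zero)
      γ₀≈0 = decidable-stable (isZero? (γ zero)) (v∉span ∘ in-span)
      γ-tail≈0 : ∀ t → IsZero (γ (suc t))
      γ-tail≈0 = u-indep (γ ∘ suc) λ i →
        ≈0⇒IsZero (+≈0⇒≈0ʳ (IsZero⇒≈0 (γ≈0 i)) (*-zeroˡ-≈ (v i) (IsZero⇒≈0 γ₀≈0)))

  module Pencil {n R : ℕ} (P Q : Fin n → Fin R → ℕ) (P-independent : Independent (λ b a → P a b)) where

    InKernel : ℕ → (Fin R → ℕ) → Set
    InKernel y v = ∀ a → IsZero ((P · v) a + y * (Q · v) a)

    kernel-scale : ∀ {y v} s → InKernel y v → InKernel y (λ b → s * v b)
    kernel-scale {y} {v} s v∈ker a = ≈0⇒IsZero (begin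
      ((P · (λ b → s * v b)) a + y * (Q · (λ b → s * v b)) a) % p
        ≡⟨ cong₂ (λ u t → (u + y * t) % p) (·-scale P s v a) (·-scale Q s v a) ⟩
      (s * (P · v) a + y * (s * (Q · v) a)) % p ≡⟨ ≡⇒≈ (factor s ((P · v) a) y ((Q · v) a)) ⟩
      (s * ((P · v) a + y * (Q · v) a)) % p     ≡⟨ *-zeroʳ-≈ s (IsZero⇒≈0 (v∈ker a)) ⟩
      0 % p                                     ∎)
      where
      open ≡-Reasoning
      factor : ∀ s A y B → s * A + y * (s * B) ≡ s * (A + y * B)
      factor = solve-∀

    kernel-at-zero : ∀ {y v} → IsZero y → InKernel y v → ∀ b → IsZero (v b)
    kernel-at-zero {y} {v} y≈0 v∈ker = P-independent v λ a →
      ≈0⇒IsZero (+≈0⇒≈0ˡ (IsZero⇒≈0 (v∈ker a)) (*-zeroˡ-≈ ((Q · v) a) (IsZero⇒≈0 y≈0)))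

    kernel-normalise : ∀ {y v} → InKernel y v → ∀ a → (P · (λ b → inv y * v b)) a + (Q · v) a ≈ 0
    kernel-normalise {y} {v} v∈ker a = cases (isZero? y)
      where
      open ≡-Reasoning
      factor : ∀ i A y B → i * A + i * y * B ≡ i * (A + y * B)
      factor = solve-∀
      cases : Dec (IsZero y) → (P · (λ b → inv y * v b)) a + (Q · v) a ≈ 0
      cases (yes y≈0) = +-cong {b = (Q · v) a} {0}
        (·-≈0 P (λ b → *-zeroʳ-≈ (inv y) (IsZero⇒≈0 (kernel-at-zero {y} {v} y≈0 v∈ker b))) a)
        (·-≈0 Q (λ b → IsZero⇒≈0 (kernel-at-zero {y} {v} y≈0 v∈ker b)) a)
      cases (no y≉0) = begin
        ((P · (λ b → inv y * v b)) a + (Q · v) a) % p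
          ≡⟨ cong (λ t → (t + (Q · v) a) % p) (·-scale P (inv y) v a) ⟩
        (inv y * (P · v) a + (Q · v) a) % p
          ≡⟨ +-cong {inv y * (P · v) a} refl (trans (≡⇒≈ (sym (*-identityˡ _))) (*-cong (sym (*-inverseˡ y≉0)) refl)) ⟩
        (inv y * (P · v) a + inv y * y * (Q · v) a) % p
          ≡⟨ ≡⇒≈ (factor (inv y) ((P · v) a) y ((Q · v) a)) ⟩
        (inv y * ((P · v) a + y * (Q · v) a)) % p
          ≡⟨ *-zeroʳ-≈ (inv y) (IsZero⇒≈0 (v∈ker a)) ⟩
        0 % p ∎

    normalised-sum-vanishes : ∀ k (y : Fin k → ℕ) (v : Fin k → Fin R → ℕ) →
      (∀ j → InKernel (y j) (v j)) → (∀ b → IsZero (sumFin k (λ j → v j b))) →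
      ∀ b → IsZero (sumFin k (λ j → inv (y j) * v j b))
    normalised-sum-vanishes k y v v∈ker Σv≈0 = P-independent _ λ a → ≈0⇒IsZero (+≈0⇒≈0ˡ
      (trans (≡⇒≈ (sym (trans (sumFin-+ k _ _)
                             (cong₂ _+_ (·-sumFin k P (λ j b → inv (y j) * v j b) a) (·-sumFin k Q v a)))))
             (sumFin-≈0 k (λ j → kernel-normalise (v∈ker j) a)))
      (·-≈0 Q (λ b → IsZero⇒≈0 (Σv≈0 b)) a))

    -- The normalised equations give Σ y_j⁻¹ v_j = 0, so the vectors (y_j⁻¹ − y₀⁻¹) v_j (j ≥ 1) lie
    -- in the kernels and sum to zero; the induction hypothesis and y_j⁻¹ ≉ y₀⁻¹ finish.
    kernels-independent : ∀ k (y : Fin k → ℕ) (v : Fin k → Fin R → ℕ) →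
      (∀ j j′ → j ≢ j′ → ¬ (y j ≈ y j′)) → (∀ j → InKernel (y j) (v j)) →
      (∀ b → IsZero (sumFin k (λ j → v j b))) → ∀ j b → IsZero (v j b)
    kernels-independent zero    y v distinct v∈ker Σv≈0 ()
    kernels-independent (suc k) y v distinct v∈ker Σv≈0 = λ { zero → head≈0 ; (suc j) → tail≈0 j }
      where
      y₀⁻¹ : ℕ
      y₀⁻¹ = inv (y zero)
      scale : Fin k → ℕ
      scale j = inv (y (suc j)) + neg y₀⁻¹
      scaled-tail : Fin k → Fin R → ℕ
      scaled-tail j b = scale j * v (suc j) b
      scaled-sum≈0 : ∀ b → IsZero (sumFin k (λ j → scaled-tail j b))
      scaled-sum≈0 b = ≈0⇒IsZero (+≈0⇒≈0ˡ (trans (≡⇒≈ regroup) both≈0) head-terms≈0)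
        where
        T₁ T₂ : ℕ
        T₁ = sumFin k (λ j → inv (y (suc j)) * v (suc j) b)
        T₂ = sumFin k (λ j → v (suc j) b)
        rearrange : ∀ a b c d e → (a + e * b) + (c * d + e * d) ≡ (c * d + a) + e * (d + b)
        rearrange = solve-∀
        regroup : sumFin k (λ j → scaled-tail j b) + (y₀⁻¹ * v zero b + neg y₀⁻¹ * v zero b)
                ≡ (y₀⁻¹ * v zero b + T₁) + neg y₀⁻¹ * (v zero b + T₂)
        regroup = trans (cong (_+ (y₀⁻¹ * v zero b + neg y₀⁻¹ * v zero b))
                         (trans (sumFin-cong k (λ j → *-distribʳ-+ (v (suc j) b) (inv (y (suc j))) (neg y₀⁻¹)))
                                (trans (sumFin-+ k _ _) (cong (T₁ +_) (sumFin-*ˡ k (neg y₀⁻¹) (λ j → v (suc j) b))))))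
                        (rearrange T₁ T₂ y₀⁻¹ (v zero b) (neg y₀⁻¹))
        both≈0 : (y₀⁻¹ * v zero b + T₁) + neg y₀⁻¹ * (v zero b + T₂) ≈ 0
        both≈0 = +-cong (IsZero⇒≈0 (normalised-sum-vanishes (suc k) y v v∈ker Σv≈0 b))
                        (*-zeroʳ-≈ (neg y₀⁻¹) (IsZero⇒≈0 (Σv≈0 b)))
        head-terms≈0 : y₀⁻¹ * v zero b + neg y₀⁻¹ * v zero b ≈ 0
        head-terms≈0 = trans (≡⇒≈ (sym (*-distribʳ-+ (v zero b) y₀⁻¹ (neg y₀⁻¹)))) (*-zeroˡ-≈ (v zero b) (+-neg≈0 y₀⁻¹))
      scaled-tail≈0 : ∀ j b → IsZero (scaled-tail j b)
      scaled-tail≈0 = kernels-independent k (y ∘ suc) scaled-tail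
        (λ j j′ j≢j′ → distinct (suc j) (suc j′) (j≢j′ ∘ fsuc-injective))
        (λ j → kernel-scale {y (suc j)} {v (suc j)} (scale j) (v∈ker (suc j))) scaled-sum≈0
      tail≈0 : ∀ j b → IsZero (v (suc j) b)
      tail≈0 j b = cases (isZero? (y (suc j))) (isZero? (scale j))
        where
        cases : Dec (IsZero (y (suc j))) → Dec (IsZero (scale j)) → IsZero (v (suc j) b)
        cases (yes y≈0) _         = kernel-at-zero {y (suc j)} {v (suc j)} y≈0 (v∈ker (suc j)) b
        cases (no _)    (no s≉0)  = noZeroDivisorsʳ (scaled-tail≈0 j b) s≉0
        cases (no y≉0)  (yes s≈0) =
          ⊥-elim (distinct (suc j) zero (λ ()) (inv-injective y≉0 (+-neg⇒≈ (IsZero⇒≈0 s≈0))))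
      head≈0 : ∀ b → IsZero (v zero b)
      head≈0 b = ≈0⇒IsZero (+≈0⇒≈0ˡ (IsZero⇒≈0 (Σv≈0 b)) (sumFin-≈0 k (λ j → IsZero⇒≈0 (tail≈0 j b))))

  module PencilRankBound {m n : ℕ} (A₀ A₁ : Fin n → Fin n → ℕ) (x : Fin m → ℕ)
    (distinct : ∀ i j → i ≢ j → ¬ (x i ≈ x j))
    (M : Fin m → Fin n → Fin n → ℕ) (M≈A₀+xA₁ : ∀ i a b → M i a b ≈ A₀ a b + x i * A₁ a b)
    (ρ : Fin m → ℕ) (T : ∀ i → Fin (ρ i) → Fin n)
    (T-independent : ∀ i → LinIndepCols p (M i) (T i))
    (T-spans : ∀ i c → InSpan (λ t a → M i a (T i t)) (λ a → M i a c))
    (i₀ : Fin m) where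

    R : ℕ
    R = ρ i₀

    S : Fin R → Fin n
    S = T i₀

    P Q : Fin n → Fin R → ℕ
    P a b = A₀ a (S b) + x i₀ * A₁ a (S b)
    Q a b = A₁ a (S b)

    open Pencil P Q (Independent-resp-≈ (λ b a → M≈A₀+xA₁ i₀ a (S b)) (T-independent i₀))

    y : Fin m → ℕ
    y i = x i + neg (x i₀)

    M≈P+yQ : ∀ i a b → M i a (S b) ≈ P a b + y i * Q a b
    M≈P+yQ i a b = begin
      M i a (S b) % p                         ≡⟨ M≈A₀+xA₁ i a (S b) ⟩
      (A₀ a (S b) + x i * Q a b) % p          ≡⟨ ≡⇒≈ (+-identityʳ _) ⟨
      (A₀ a (S b) + x i * Q a b + 0) % p      ≡⟨ +-cong {A₀ a (S b) + x i * Q a b} refl (*-zeroˡ-≈ (Q a b) (+-neg≈0 (x i₀))) ⟨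
      (A₀ a (S b) + x i * Q a b + (x i₀ + neg (x i₀)) * Q a b) % p
                                              ≡⟨ ≡⇒≈ (regroup (A₀ a (S b)) (x i₀) (Q a b) (x i) (neg (x i₀))) ⟩
      (P a b + y i * Q a b) % p               ∎
      where
      open ≡-Reasoning
      regroup : ∀ u x₀ w xᵢ n₀ → u + xᵢ * w + (x₀ + n₀) * w ≡ u + x₀ * w + (xᵢ + n₀) * w
      regroup = solve-∀

    α : ∀ i → Fin R → Fin (ρ i) → ℕ
    α i b = proj₁ (T-spans i (S b))

    blockCoordinate : Fin m → Fin R → Σ (Fin m) (Fin ∘ ρ) → ℕ
    blockCoordinate i b (i′ , t) with i ≟ᶠ i′
    ... | yes refl = α i b t
    ... | no  _    = 0

    blockCoordinate-same : ∀ i b t → blockCoordinate i b (i , t) ≡ α i b t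
    blockCoordinate-same i b t with i ≟ᶠ i
    ... | yes refl = refl
    ... | no  i≢i  = ⊥-elim (i≢i refl)

    blockCoordinate-≢ : ∀ {i i′} b t → i ≢ i′ → blockCoordinate i b (i′ , t) ≡ 0
    blockCoordinate-≢ {i} {i′} b t i≢i′ with i ≟ᶠ i′
    ... | yes i≡i′ = ⊥-elim (i≢i′ i≡i′)
    ... | no  _    = refl

    lift : Fin m → Fin R → Fin (R + sumFin m ρ) → ℕ
    lift i b = [ δ b , blockCoordinate i b ∘ blockOf ρ ] ∘ splitAt R

    family : Fin (m * R) → Fin (R + sumFin m ρ) → ℕ
    family z = uncurry lift (remQuot R z)

    y-distinct : ∀ i j → i ≢ j → ¬ (y i ≈ y j)
    y-distinct i j i≢j yᵢ≈yⱼ = distinct i j i≢j (+-cancelʳ-≈ (neg (x i₀)) yᵢ≈yⱼ)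

    module Vanishing (c : Fin (m * R) → ℕ)
      (c·family≈0 : ∀ w → IsZero (sumFin (m * R) (λ z → c z * family z w))) where

      C : Fin m → Fin R → ℕ
      C i b = c (combine i b)

      lifted≈0 : ∀ w → IsZero (sumFin m (λ i → sumFin R (λ b → C i b * lift i b w)))
      lifted≈0 w = subst IsZero
        (trans (sumFin-combine m R (λ z → c z * family z w))
               (sumFin-cong m (λ i → sumFin-cong R (λ b →
                 cong (λ q → C i b * uncurry lift q w) (remQuot-combine {m} {R} i b)))))
        (c·family≈0 w)

      column-sums≈0 : ∀ b′ → IsZero (sumFin m (λ i → C i b′))
      column-sums≈0 b′ = subst IsZero
        (sumFin-cong m (λ i → trans (sumFin-cong R (λ b → cong (λ e → C i b * [ δ b , _ ] e) (splitAt-↑ˡ R b′ (sumFin m ρ))))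
                                    (sumFin-δ R (C i) b′)))
        (lifted≈0 (b′ ↑ˡ sumFin m ρ))

      block-sums≈0 : ∀ i t → IsZero (sumFin R (λ b → C i b * α i b t))
      block-sums≈0 i′ t = subst IsZero
        (trans (sumFin-cong m (λ i → sumFin-cong R (λ b → cong (C i b *_) (lift-block i b))))
          (trans (sumFin-single m _ i′ (λ i i≢i′ → trans (sumFin-cong R (λ b →
                    trans (cong (C i b *_) (blockCoordinate-≢ b t i≢i′)) (*-zeroʳ (C i b)))) (sumFin-zero R)))
                 (sumFin-cong R (λ b → cong (C i′ b *_) (blockCoordinate-same i′ b t)))))
        (lifted≈0 (R ↑ʳ inBlock ρ i′ t))
        where
        lift-block : ∀ i b → lift i b (R ↑ʳ inBlock ρ i′ t) ≡ blockCoordinate i b (i′ , t)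
        lift-block i b rewrite splitAt-↑ʳ R (sumFin m ρ) (inBlock ρ i′ t) | blockOf-inBlock ρ i′ t = refl

      C-in-kernel : ∀ i → InKernel (y i) (C i)
      C-in-kernel i a = ≈0⇒IsZero (begin
        ((P · C i) a + y i * (Q · C i) a) % p
          ≡⟨ ≡⇒≈ (pencil-· (C i)) ⟩
        sumFin R (λ b → C i b * (P a b + y i * Q a b)) % p
          ≡⟨ sumFin-cong-≈ R (λ b → *-cong {C i b} refl (M≈P+yQ i a b)) ⟨
        sumFin R (λ b → C i b * M i a (S b)) % p
          ≡⟨ sumFin-cong-≈ R (λ b → *-cong {C i b} refl (proj₂ (T-spans i (S b)) a)) ⟩
        sumFin R (λ b → C i b * (N · α i b) a) % p
          ≡⟨ ≡⇒≈ (sumFin-cong R (λ b → sym (·-scale N (C i b) (α i b) a))) ⟩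
        sumFin R (λ b → (N · (λ t → C i b * α i b t)) a) % p
          ≡⟨ ≡⇒≈ (·-sumFin R N (λ b t → C i b * α i b t) a) ⟩
        (N · (λ t → sumFin R (λ b → C i b * α i b t))) a % p
          ≡⟨ ·-≈0 N (λ t → IsZero⇒≈0 (block-sums≈0 i t)) a ⟩
        0 % p ∎)
        where
        open ≡-Reasoning
        N : Fin n → Fin (ρ i) → ℕ
        N a t = M i a (T i t)
        expand : ∀ c u y v → c * u + y * c * v ≡ c * (u + y * v)
        expand = solve-∀
        pencil-· : ∀ v → (P · v) a + y i * (Q · v) a ≡ sumFin R (λ b → v b * (P a b + y i * Q a b))
        pencil-· v = sym (trans (sumFin-cong R (λ b → sym (expand (v b) (P a b) (y i) (Q a b))))
                                (trans (sumFin-+ R _ _) (cong ((P · v) a +_) (·-scale Q (y i) v a))))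

      C≈0 : ∀ i b → IsZero (C i b)
      C≈0 = kernels-independent m y C y-distinct C-in-kernel column-sums≈0

    family-independent : Independent family
    family-independent c c·family≈0 z =
      subst (IsZero ∘ c) (combine-remQuot {m} R z) (C≈0 (proj₁ (remQuot {m} R z)) (proj₂ (remQuot {m} R z)))
      where open Vanishing c c·family≈0

    rank-bound : m * R ≤ R + sumFin m ρ
    rank-bound = independent⇒≤ (m * R) (R + sumFin m ρ) family family-independent

  -- Maximality of the columns T i yields spanning only under double negation, which the
  -- decidable goal absorbs.
  pencil-rank-bound : ∀ {m n} (A₀ A₁ : Fin n → Fin n → ℕ) (x : Fin m → ℕ) →
    (∀ i j → i ≢ j → ¬ (x i ≈ x j)) →
    (M : Fin m → Fin n → Fin n → ℕ) → (∀ i a b → M i a b ≈ A₀ a b + x i * A₁ a b) →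
    (ρ : Fin m → ℕ) → (∀ i → HasRank p (M i) (ρ i)) →
    ∀ i₀ → m * ρ i₀ ≤ ρ i₀ + sumFin m ρ
  pencil-rank-bound {m} {n} A₀ A₁ x distinct M M≈A₀+xA₁ ρ rank i₀ =
    decidable-stable (_ ≤? _) λ ≰ → ¬¬-Π m (λ i → ¬¬-Π n (T-spans i)) λ spans →
      ≰ (PencilRankBound.rank-bound A₀ A₁ x distinct M M≈A₀+xA₁ ρ T T-independent spans i₀)
    where
    T : ∀ i → Fin (ρ i) → Fin n
    T i = proj₁ (proj₁ (rank i))
    T-independent : ∀ i → LinIndepCols p (M i) (T i)
    T-independent i = proj₂ (proj₁ (rank i))
    T-spans : ∀ i c → ¬ ¬ InSpan (λ t a → M i a (T i t)) (λ a → M i a c)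
    T-spans i c = dependent-extension-spans _ (λ a → M i a c) (T-independent i) λ indep →
      proj₂ (rank i) (c ∷ T i)
        (Independent-resp-≈ {u = (λ a → M i a c) ∷ (λ t a → M i a (T i t))} {v = λ t a → M i a ((c ∷ T i) t)}
                            (λ { zero a → refl ; (suc t) a → refl }) indep)

  p∣higherTerms : ∀ {n} j (A : ℕ → MatZp p n) xs a b → p ∣ higherTerms p j A xs a b 1
  p∣higherTerms zero    A xs a b = divides 0 refl
  p∣higherTerms (suc j) A xs a b =
    ∣m∣n⇒∣m+n (p∣higherTerms j A xs a b) (∣m⇒∣m*n _ (∣m⇒∣m*n _ (m∣m*n (p ^ j))))

  -- All terms of a first integral beyond A₀ + t A₁ carry a factor p.
  firstIntegral≈A₀+xA₁ : ∀ {n} r (A : ℕ → MatZp p n) (z : ℤp p) a b →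
    redEvalFI p r A z a b ≈ rep p (A 0 a b) 1 + rep p z 1 * rep p (A 1 a b) 1
  firstIntegral≈A₀+xA₁ r A z a b =
    trans (m%n%n≡m%n (evalFI p r A z a b 1) p) (%-remove-+ʳ _ (p∣higherTerms r A (rep p z) a b))

lemma3p3 : (p : ℕ) .{{_ : NonZero p}} → Prime p →
           (m : ℕ) (X : Fin m → ℤp p) →
           (∀ i j → i ≢ j → red p (X i) ≢ red p (X j)) →
           (n : ℕ) (H : Fin m → FGModule) →
           InC p X n H →
           ∃ λ (α₀ : ℕ) → (∀ i → d₀ n (H i) ≤ α₀) ×
             ((m ∸ 1) * α₀ ≤ sumFin m (λ i → d₀ n (H i)))
lemma3p3 p p-prime zero    X distinct n H _ = 0 , (λ ()) , z≤n
lemma3p3 p p-prime (suc m) X distinct n H (_ , r , A , cok) = ρ i₀ , ρ≤ρi₀ ,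
  +-cancelˡ-≤ (ρ i₀) _ _ (pencil-rank-bound A₀ A₁ x distinct (redEvalFI p r A ∘ X)
                            (λ i → firstIntegral≈A₀+xA₁ r A (X i)) ρ (proj₂ ∘ cok) i₀)
  where
  open PrimeField p p-prime
  ρ : Fin (suc m) → ℕ
  ρ i = d₀ n (H i)
  x : Fin (suc m) → ℕ
  x i = rep p (X i) 1
  A₀ A₁ : Fin n → Fin n → ℕ
  A₀ a b = rep p (A 0 a b) 1
  A₁ a b = rep p (A 1 a b) 1
  i₀ : Fin (suc m)
  i₀ = proj₁ (maxIndex m ρ)
  ρ≤ρi₀ : ∀ i → ρ i ≤ ρ i₀
  ρ≤ρi₀ = proj₂ (maxIndex m ρ)
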